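{- Let $m\ge1$ and let $u_1,u_2,\dots,u_m$ be integers with $u_1=-1$ such that for each $1<k\le m$, \[ u_k=-(u_{r_k}+u_{r_k+1}+\cdots+u_{k-1}) \] for some integer $r_k$ with $1\le r_k\le k-1$. Suppose in addition that $r_{k-1}\le r_k$ for $2<k\le m$. Then for each $1<k\le m$, at most two of the terms $u_{r_k},u_{r_k+1},\dots,u_{k-1}$ are nonzero. Thus $u_k$ is nonzero if and only if exactly one of $u_{r_k},\dots,u_{k-1}$ is nonzero. -}

module Defs where

open import Data.Nat using (ℕ; zero; suc; _+_; _∸_)
open import Data.Integer using (ℤ)
import Data.Integer as ℤ
open import Data.List using (List; map; filter; length; upTo; foldr)
open import Relation.Nullary using (¬_)
open import Relation.Nullary.Decidable using (¬?)
open import Relation.Binary.PropositionalEquality using (_≡_)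

range : ℕ → ℕ → List ℕ
range a b = map (a +_) (upTo (b ∸ a))

rangeSum : (ℕ → ℤ) → ℕ → ℕ → ℤ
rangeSum u a b = foldr ℤ._+_ (ℤ.+ 0) (map u (range a b))

nonzeroCount : (ℕ → ℤ) → ℕ → ℕ → ℕ
nonzeroCount u a b = length (filter (λ i → ¬? (u i ℤ.≟ ℤ.+ 0)) (range a b))

-- Call a window [a, b) sparse if it has at most one nonzero term, or exactly two that
-- cancel.  By induction on b, every window [a, b) with 1 ≤ a < b and r b ≤ a is sparse.
-- Appending a term u b ≠ 0 to [a, b): the window [r b, b) has total −u b ≠ 0, so being
-- sparse it has exactly one nonzero term, and since r is monotone [a, b) sits inside it.
-- Either that term lies before a, and [a, b + 1) has u b as its only nonzero term, or it
-- lies in [a, b) and equals the total −u b, which then cancels against u b.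
module Submission where

open import Defs
open import Data.Nat using (ℕ; zero; suc; _+_; _∸_; _≤_; _<_; z≤n; s≤s)
open import Data.Nat.Properties
  using (≤-refl; ≤-reflexive; ≤-trans; n≤1+n; ≤-antisym; <⇒≤; ≤-<-trans; m≤n⇒m<n∨m≡n; n≢0⇒n>0; n∸n≡0;
         +-∸-assoc; m+[n∸m]≡n; +-identityʳ; suc-injective)
open import Data.Integer using (ℤ; -[1+_]; +_; -_)
import Data.Integer as ℤ
import Data.Integer.Properties as ℤ
open import Data.List using (List; []; _∷_; [_]; _++_; _∷ʳ_; map; filter; length; upTo; foldr)
open import Data.List.Properties using (map-++; upTo-∷ʳ; ++-assoc; ++-identityʳ; filter-++; length-++)
open import Data.Product using (_×_; _,_; proj₁; proj₂)
open import Data.Sum using (_⊎_; inj₁; inj₂)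
open import Data.Empty using (⊥-elim)
open import Function using (_∘_)
open import Function.Bundles using (_⇔_; mk⇔)
open import Relation.Nullary using (¬_; Dec; yes; no)
open import Relation.Nullary.Decidable using (¬?)
open import Relation.Binary.PropositionalEquality
  using (_≡_; _≢_; refl; sym; trans; cong; cong₂; subst; module ≡-Reasoning)
open ≡-Reasoning

m+n≡1⇒m≡0×n≡1∨m≡1×n≡0 : ∀ m n → m + n ≡ 1 → (m ≡ 0 × n ≡ 1) ⊎ (m ≡ 1 × n ≡ 0)
m+n≡1⇒m≡0×n≡1∨m≡1×n≡0 zero          n    eq = inj₁ (refl , eq)
m+n≡1⇒m≡0×n≡1∨m≡1×n≡0 (suc zero)    zero refl = inj₂ (refl , refl)

i≡-j⇒j≡-i : ∀ {i j : ℤ} → i ≡ - j → j ≡ - i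
i≡-j⇒j≡-i {i} {j} i≡-j = sym (trans (cong -_ i≡-j) (ℤ.neg-involutive j))

range-self : ∀ a → range a a ≡ []
range-self a rewrite n∸n≡0 a = refl

range-∷ʳ : ∀ {a b} → a ≤ b → range a (suc b) ≡ range a b ∷ʳ b
range-∷ʳ {a} {b} a≤b = begin
  map (_+_ a) (upTo (suc b ∸ a))        ≡⟨ cong (map (_+_ a) ∘ upTo) (+-∸-assoc 1 a≤b) ⟩
  map (_+_ a) (upTo (suc (b ∸ a)))      ≡⟨ cong (map (_+_ a)) (sym (upTo-∷ʳ (b ∸ a))) ⟩
  map (_+_ a) (upTo (b ∸ a) ∷ʳ (b ∸ a)) ≡⟨ map-++ (_+_ a) (upTo (b ∸ a)) [ b ∸ a ] ⟩
  range a b ∷ʳ (a + (b ∸ a))           ≡⟨ cong (range a b ∷ʳ_) (m+[n∸m]≡n a≤b) ⟩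
  range a b ∷ʳ b                       ∎

range-singleton : ∀ a → range a (suc a) ≡ [ a ]
range-singleton a = trans (range-∷ʳ ≤-refl) (cong (_∷ʳ a) (range-self a))

range-++ : ∀ {a b c} → a ≤ b → b ≤ c → range a c ≡ range a b ++ range b c
range-++ {a} {b} {c} a≤b b≤c with m≤n⇒m<n∨m≡n b≤c
... | inj₂ refl = begin
  range a b              ≡⟨ sym (++-identityʳ (range a b)) ⟩
  range a b ++ []        ≡⟨ cong (range a b ++_) (sym (range-self b)) ⟩
  range a b ++ range b b ∎
range-++ {a} {b} {suc c} a≤b b≤c | inj₁ (s≤s b≤c′) = begin
  range a (suc c)                ≡⟨ range-∷ʳ (≤-trans a≤b b≤c′) ⟩
  range a c ∷ʳ c                 ≡⟨ cong (_∷ʳ c) (range-++ a≤b b≤c′) ⟩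
  (range a b ++ range b c) ∷ʳ c  ≡⟨ ++-assoc (range a b) (range b c) [ c ] ⟩
  range a b ++ (range b c ∷ʳ c)  ≡⟨ cong (range a b ++_) (sym (range-∷ʳ b≤c′)) ⟩
  range a b ++ range b (suc c)   ∎

-- Windows generalised to arbitrary lists of indices: rangeSum u a b and nonzeroCount u a b
-- are definitionally total (range a b) and nonzeros (range a b).
module Window (u : ℕ → ℤ) where

  nonzero? : ∀ i → Dec (¬ u i ≡ + 0)
  nonzero? i = ¬? (u i ℤ.≟ + 0)

  total : List ℕ → ℤ
  total is = foldr ℤ._+_ (+ 0) (map u is)

  nonzeros : List ℕ → ℕ
  nonzeros is = length (filter nonzero? is)

  total-++ : ∀ is js → total (is ++ js) ≡ total is ℤ.+ total js
  total-++ []       js = sym (ℤ.+-identityˡ (total js))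
  total-++ (i ∷ is) js = begin
    u i ℤ.+ total (is ++ js)         ≡⟨ cong (ℤ._+_ (u i)) (total-++ is js) ⟩
    u i ℤ.+ (total is ℤ.+ total js)  ≡⟨ sym (ℤ.+-assoc (u i) (total is) (total js)) ⟩
    (u i ℤ.+ total is) ℤ.+ total js  ∎

  nonzeros-++ : ∀ is js → nonzeros (is ++ js) ≡ nonzeros is + nonzeros js
  nonzeros-++ is js = trans (cong length (filter-++ nonzero? is js)) (length-++ (filter nonzero? is))

  total-[_] : ∀ i → total [ i ] ≡ u i
  total-[ i ] = ℤ.+-identityʳ (u i)

  nonzeros-[_]-zero : ∀ i → u i ≡ + 0 → nonzeros [ i ] ≡ 0
  nonzeros-[ i ]-zero z with u i ℤ.≟ + 0
  ... | yes _ = refl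
  ... | no nz = ⊥-elim (nz z)

  nonzeros-[_]-nonzero : ∀ i → u i ≢ + 0 → nonzeros [ i ] ≡ 1
  nonzeros-[ i ]-nonzero nz with u i ℤ.≟ + 0
  ... | yes z = ⊥-elim (nz z)
  ... | no _  = refl

  nonzeros≡0⇒total≡0 : ∀ is → nonzeros is ≡ 0 → total is ≡ + 0
  nonzeros≡0⇒total≡0 []       _ = refl
  nonzeros≡0⇒total≡0 (i ∷ is) n≡0 with u i ℤ.≟ + 0
  ... | yes z = cong₂ ℤ._+_ z (nonzeros≡0⇒total≡0 is n≡0)

  nonzeros≡1⇒total≢0 : ∀ is → nonzeros is ≡ 1 → total is ≢ + 0
  nonzeros≡1⇒total≢0 (i ∷ is) n≡1 t≡0 with u i ℤ.≟ + 0
  ... | yes z  = nonzeros≡1⇒total≢0 is n≡1 (begin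
    total is            ≡⟨ sym (ℤ.+-identityˡ (total is)) ⟩
    + 0 ℤ.+ total is    ≡⟨ cong (ℤ._+ total is) (sym z) ⟩
    u i ℤ.+ total is    ≡⟨ t≡0 ⟩
    + 0                 ∎)
  ... | no nz = nz (begin
    u i                 ≡⟨ sym (ℤ.+-identityʳ (u i)) ⟩
    u i ℤ.+ + 0         ≡⟨ cong (ℤ._+_ (u i)) (sym (nonzeros≡0⇒total≡0 is (suc-injective n≡1))) ⟩
    u i ℤ.+ total is    ≡⟨ t≡0 ⟩
    + 0                 ∎)

  Sparse : List ℕ → Set
  Sparse is = nonzeros is ≤ 1 ⊎ (nonzeros is ≡ 2 × total is ≡ + 0)

  Sparse⇒nonzeros≤2 : ∀ is → Sparse is → nonzeros is ≤ 2
  Sparse⇒nonzeros≤2 _ (inj₁ n≤1)      = ≤-trans n≤1 (s≤s z≤n)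
  Sparse⇒nonzeros≤2 _ (inj₂ (n≡2 , _)) = ≤-reflexive n≡2

  Sparse⇒total≢0⇒nonzeros≡1 : ∀ is → Sparse is → total is ≢ + 0 → nonzeros is ≡ 1
  Sparse⇒total≢0⇒nonzeros≡1 is (inj₁ n≤1) t≢0 =
    ≤-antisym n≤1 (n≢0⇒n>0 (t≢0 ∘ nonzeros≡0⇒total≡0 is))
  Sparse⇒total≢0⇒nonzeros≡1 _ (inj₂ (_ , t≡0)) t≢0 = ⊥-elim (t≢0 t≡0)

  Sparse-[_] : ∀ i → Sparse [ i ]
  Sparse-[ i ] with u i ℤ.≟ + 0
  ... | yes _ = inj₁ z≤n
  ... | no _  = inj₁ ≤-refl

  Sparse-∷ʳ-zero : ∀ is b → u b ≡ + 0 → Sparse is → Sparse (is ∷ʳ b)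
  Sparse-∷ʳ-zero is b z sparse
    rewrite nonzeros-++ is [ b ] | nonzeros-[ b ]-zero z | +-identityʳ (nonzeros is)
          | total-++ is [ b ] | total-[ b ] | z | ℤ.+-identityʳ (total is)
    = sparse

  -- Used with js = range (r b) a and is = range a b.
  Sparse-∷ʳ-nonzero : ∀ js is b → nonzeros (js ++ is) ≡ 1 → total (js ++ is) ≡ - u b →
                      Sparse (is ∷ʳ b)
  Sparse-∷ʳ-nonzero js is b n≡1 t≡-ub = extend ub≢0
    where
    ub≢0 : u b ≢ + 0
    ub≢0 ub≡0 = nonzeros≡1⇒total≢0 (js ++ is) n≡1 (trans t≡-ub (cong -_ ub≡0))

    total-is : nonzeros js ≡ 0 → total is ≡ - u b
    total-is js≡0 = begin
      total is                ≡⟨ sym (ℤ.+-identityˡ (total is)) ⟩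
      + 0 ℤ.+ total is        ≡⟨ cong (ℤ._+ total is) (sym (nonzeros≡0⇒total≡0 js js≡0)) ⟩
      total js ℤ.+ total is   ≡⟨ sym (total-++ js is) ⟩
      total (js ++ is)        ≡⟨ t≡-ub ⟩
      - u b                   ∎

    extend : u b ≢ + 0 → Sparse (is ∷ʳ b)
    extend nz
      rewrite nonzeros-++ is [ b ] | nonzeros-[ b ]-nonzero nz | total-++ is [ b ] | total-[ b ]
      with m+n≡1⇒m≡0×n≡1∨m≡1×n≡0 (nonzeros js) (nonzeros is) (trans (sym (nonzeros-++ js is)) n≡1)
    ... | inj₂ (_ , is≡0) rewrite is≡0 = inj₁ ≤-refl
    ... | inj₁ (js≡0 , is≡1) rewrite is≡1 = inj₂ (refl , (begin
      total is ℤ.+ u b        ≡⟨ cong (ℤ._+ u b) (total-is js≡0) ⟩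
      - u b ℤ.+ u b           ≡⟨ ℤ.+-inverseˡ (u b) ⟩
      + 0                     ∎))

module _ (m : ℕ) (u : ℕ → ℤ) (r : ℕ → ℕ)
  (recurrence : ∀ k → 1 < k → k ≤ m → (1 ≤ r k) × (r k < k) × (u k ≡ - rangeSum u (r k) k))
  (r-mono : ∀ k → 2 < k → k ≤ m → r (k ∸ 1) ≤ r k) where
  open Window u

  range-sparse : ∀ b → b ≤ m → ∀ a → 1 ≤ a → a < b → r b ≤ a → Sparse (range a b)
  range-sparse (suc b) sb≤m a 1≤a (s≤s a≤b) rsb≤a with m≤n⇒m<n∨m≡n a≤b
  ... | inj₂ refl = subst Sparse (sym (range-singleton a)) Sparse-[ a ]
  ... | inj₁ a<b = subst Sparse (sym (range-∷ʳ a≤b)) (extend (u b ℤ.≟ + 0))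
    where
    b≤m : b ≤ m
    b≤m = ≤-trans (n≤1+n b) sb≤m

    1<b : 1 < b
    1<b = ≤-<-trans 1≤a a<b

    rb≤a : r b ≤ a
    rb≤a = ≤-trans (r-mono (suc b) (s≤s 1<b) sb≤m) rsb≤a

    extend : Dec (u b ≡ + 0) → Sparse (range a b ∷ʳ b)
    extend (yes ub≡0) = Sparse-∷ʳ-zero (range a b) b ub≡0 (range-sparse b b≤m a 1≤a a<b rb≤a)
    extend (no ub≢0)  = Sparse-∷ʳ-nonzero (range (r b) a) (range a b) b
      (subst (λ is → nonzeros is ≡ 1) window-split
        (Sparse⇒total≢0⇒nonzeros≡1 (range (r b) b) (range-sparse b b≤m (r b) 1≤rb rb<b ≤-refl) total≢0))
      (subst (λ is → total is ≡ - u b) window-split total≡-ub)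
      where
      1≤rb : 1 ≤ r b
      1≤rb = proj₁ (recurrence b 1<b b≤m)

      rb<b : r b < b
      rb<b = proj₁ (proj₂ (recurrence b 1<b b≤m))

      total≡-ub : rangeSum u (r b) b ≡ - u b
      total≡-ub = i≡-j⇒j≡-i (proj₂ (proj₂ (recurrence b 1<b b≤m)))

      total≢0 : rangeSum u (r b) b ≢ + 0
      total≢0 t≡0 = ub≢0 (trans (i≡-j⇒j≡-i total≡-ub) (cong -_ t≡0))

      window-split : range (r b) b ≡ range (r b) a ++ range a b
      window-split = range-++ rb≤a (<⇒≤ a<b)

lemma4p4 : (m : ℕ) → 1 ≤ m → (u : ℕ → ℤ) → (r : ℕ → ℕ)
    → u 1 ≡ -[1+ 0 ]
    → (∀ k → 1 < k → k ≤ m → (1 ≤ r k) × (r k < k) × (u k ≡ - rangeSum u (r k) k))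
    → (∀ k → 2 < k → k ≤ m → r (k ∸ 1) ≤ r k)
    → ∀ k → 1 < k → k ≤ m
    → (nonzeroCount u (r k) k ≤ 2) × ((u k ≢ + 0) ⇔ (nonzeroCount u (r k) k ≡ 1))
lemma4p4 m _ u r _ recurrence r-mono k 1<k k≤m with recurrence k 1<k k≤m
... | 1≤rk , rk<k , uk≡-total = Sparse⇒nonzeros≤2 (range (r k) k) sparse , mk⇔ to from
  where
  open Window u

  sparse : Sparse (range (r k) k)
  sparse = range-sparse m u r recurrence r-mono k k≤m (r k) 1≤rk rk<k ≤-refl

  to : u k ≢ + 0 → nonzeros (range (r k) k) ≡ 1
  to uk≢0 = Sparse⇒total≢0⇒nonzeros≡1 (range (r k) k) sparse (λ t≡0 → uk≢0 (trans uk≡-total (cong -_ t≡0)))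

  from : nonzeros (range (r k) k) ≡ 1 → u k ≢ + 0
  from n≡1 uk≡0 = nonzeros≡1⇒total≢0 (range (r k) k) n≡1 (trans (i≡-j⇒j≡-i uk≡-total) (cong -_ uk≡0))
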